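{- An antipodal distance-regular graph with diameter $4$ or $5$ admits no perfect $1$-code.
   Context: A connected graph of diameter $d$ is distance-regular if for any two vertices $x,y$ at distance $i$ the number of neighbours of $x$ at distance $i+1$ (resp. $i-1$) from $y$ depends only on $i$. It is antipodal if the relation "equal or at distance $d$" is an equivalence relation. A perfect $1$-code is a vertex subset $C$ such that the closed neighbourhoods of the vertices of $C$ partition the vertex set. -}

module Defs where

open import Data.Nat using (ℕ; zero; suc; _≤_)
open import Data.Bool using (Bool; true; false; _∧_; _∨_; not)
open import Data.Fin using (Fin; _≟_)
open import Data.List using (List; length; filterᵇ; allFin)
open import Data.Bool.ListAction using (any)
open import Data.Product using (Σ; ∃; ∃₂; _×_)
open import Relation.Nullary.Decidable using (isYes)
open import Relation.Binary.PropositionalEquality using (_≡_)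
open import Relation.Binary.Structures using (IsEquivalence)
open import Data.Sum using (_⊎_)

record Graph (n : ℕ) : Set where
  field
    adj    : Fin n → Fin n → Bool
    adj-sym    : ∀ x y → adj x y ≡ adj y x
    adj-irrefl : ∀ x → adj x x ≡ false
open Graph public

count : ∀ {n} → (Fin n → Bool) → ℕ
count {n} p = length (filterᵇ p (allFin n))

-- reach G k x y = true  iff  there is a walk of length ≤ k from x to y
reach : ∀ {n} → Graph n → ℕ → Fin n → Fin n → Bool
reach G zero    x y = isYes (x ≟ y)
reach G (suc k) x y = reach G k x y ∨ any (λ z → adj G x z ∧ reach G k z y) (allFin _)

atDist : ∀ {n} → Graph n → ℕ → Fin n → Fin n → Bool
atDist G zero    x y = reach G zero x y
atDist G (suc i) x y = reach G (suc i) x y ∧ not (reach G i x y)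

Connected : ∀ {n} → Graph n → Set
Connected {n} G = ∀ (x y : Fin n) → ∃ λ i → atDist G i x y ≡ true

HasDiameter : ∀ {n} → Graph n → ℕ → Set
HasDiameter {n} G d =
  (∀ (x y : Fin n) → ∃ λ i → i ≤ d × atDist G i x y ≡ true)
  × ∃₂ λ (x y : Fin n) → atDist G d x y ≡ true

DistanceRegular : ∀ {n} → Graph n → Set
DistanceRegular {n} G =
  Connected G ×
  (∃₂ λ (b c : ℕ → ℕ) →
     (∀ i (x y : Fin n) → atDist G i x y ≡ true →
        count (λ z → adj G x z ∧ atDist G (suc i) z y) ≡ b i)
   × (∀ i (x y : Fin n) → atDist G (suc i) x y ≡ true →
        count (λ z → adj G x z ∧ atDist G i z y) ≡ c (suc i)))

Antipodal : ∀ {n} → Graph n → ℕ → Set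
Antipodal {n} G d = IsEquivalence (λ (x y : Fin n) → x ≡ y ⊎ atDist G d x y ≡ true)

inClosedNbhd : ∀ {n} → Graph n → Fin n → Fin n → Bool
inClosedNbhd G c v = isYes (c ≟ v) ∨ adj G c v

PerfectCode : ∀ {n} → Graph n → (Fin n → Bool) → Set
PerfectCode {n} G C = ∀ (v : Fin n) → count (λ c → C c ∧ inClosedNbhd G c v) ≡ 1

module Submission where

-- Fix a codeword o, let Lᵢ be the set of vertices at distance i from o, lᵢ = |Lᵢ| and nᵢ = |C ∩ Lᵢ|.
-- Antipodality makes the vertices of L_D pairwise at distance D ≥ 3, so b_{D-1} = 1, c_D = k and
-- l_{D-1} = k l_D.  Counting the vertices of L_D, L_{D-1} and L₂ by the codeword whose closed
-- neighbourhood contains them gives l_D = n_{D-1} + n_D, l_{D-1} + c_{D-1} n_{D-1} = k l_D + b_{D-2} n_{D-2}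
-- and, as no codeword lies at distance 1 or 2 from o, l₂ = c₃ n₃; hence c_{D-1} n_{D-1} = b_{D-2} n_{D-2}.
-- For D = 4 this gives l₂ = b₂ n₂ = 0.  For D = 5, together with b₂ l₂ = c₃ l₃ and b₃ l₃ = c₄ l₄ it gives
-- b₂ n₄ = k l₅, which is impossible since n₄ ≤ l₅ and b₂ < k.

open import Defs
open import Data.Nat using (ℕ; zero; suc; _+_; _*_; _≤_; _<_; z≤n; s≤s; >-nonZero)
open import Data.Nat.Properties hiding (_≟_)
open import Data.Bool using (Bool; true; false; _∧_; _∨_; not)
open import Data.Bool.Properties using (∧-zeroʳ; ∧-comm; ∧-assoc; not-¬)
open import Data.Bool.ListAction using (any)
open import Data.Fin using (Fin; zero; suc; _≟_)
import Data.Fin.Properties as Fin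
open import Data.List using (_∷_; length; filterᵇ; tabulate; allFin)
open import Data.List.Membership.Propositional using (_∈_)
open import Data.List.Membership.Propositional.Properties using (∈-allFin)
open import Data.List.Relation.Unary.Any using (here; there)
open import Data.Product using (∃; _×_; _,_; proj₁; proj₂)
open import Data.Sum using (_⊎_; inj₁; inj₂)
open import Data.Empty using (⊥; ⊥-elim)
open import Function using (_∘_)
open import Relation.Nullary using (¬_; yes; no)
open import Relation.Nullary.Decidable using (isYes)
open import Relation.Binary.PropositionalEquality
open import Relation.Binary.Structures using (IsEquivalence)
open import Algebra.Properties.Semiring.Sum +-*-semiring
open import Algebra.Properties.CommutativeSemigroup *-commutativeSemigroup using (x∙yz≈y∙xz)
open import Data.Nat.Tactic.RingSolver using (solve-∀)

χ : Bool → ℕ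
χ true  = 1
χ false = 0

χ-∧ : ∀ a b → χ (a ∧ b) ≡ χ a * χ b
χ-∧ true  b = sym (+-identityʳ (χ b))
χ-∧ false b = refl

χ-cong₃ : ∀ {a b c a′ b′ c′} → a ≡ a′ → b ≡ b′ → c ≡ c′ →
  χ a + χ b + χ c ≡ χ a′ + χ b′ + χ c′
χ-cong₃ refl refl refl = refl

∧-rotate : ∀ a b c → a ∧ (b ∧ c) ≡ c ∧ (b ∧ a)
∧-rotate true  b true  = refl
∧-rotate true  b false = ∧-zeroʳ b
∧-rotate false b true  = sym (∧-zeroʳ b)
∧-rotate false b false = refl

∧-true⁻ : ∀ {a b} → a ∧ b ≡ true → a ≡ true × b ≡ true
∧-true⁻ {true} {true} _ = refl , refl

∧-true⁺ : ∀ {a b} → a ≡ true → b ≡ true → a ∧ b ≡ true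
∧-true⁺ refl refl = refl

∨-true⁻ : ∀ {a b} → a ∨ b ≡ true → a ≡ true ⊎ b ≡ true
∨-true⁻ {true}  _   = inj₁ refl
∨-true⁻ {false} b≡t = inj₂ b≡t

∨-trueˡ : ∀ {a} b → a ≡ true → a ∨ b ≡ true
∨-trueˡ b refl = refl

∨-trueʳ : ∀ a {b} → b ≡ true → a ∨ b ≡ true
∨-trueʳ true  _   = refl
∨-trueʳ false b≡t = b≡t

any-true⁻ : ∀ {A : Set} (p : A → Bool) xs → any p xs ≡ true → ∃ λ x → p x ≡ true
any-true⁻ p (x ∷ xs) any≡t with ∨-true⁻ {p x} any≡t
... | inj₁ px = x , px
... | inj₂ rest = any-true⁻ p xs rest

any-true⁺ : ∀ {A : Set} (p : A → Bool) {xs x} → x ∈ xs → p x ≡ true → any p xs ≡ true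
any-true⁺ p (here refl) px = ∨-trueˡ _ px
any-true⁺ p {y ∷ _} (there x∈xs) px = ∨-trueʳ (p y) (any-true⁺ p x∈xs px)

isYes-≡ : ∀ {n} {x y : Fin n} → isYes (x ≟ y) ≡ true → x ≡ y
isYes-≡ {x = x} {y} _ with x ≟ y
... | yes x≡y = x≡y

isYes-refl : ∀ {n} (x : Fin n) → isYes (x ≟ x) ≡ true
isYes-refl x with x ≟ x
... | yes _   = refl
... | no x≢x  = ⊥-elim (x≢x refl)

length-filterᵇ-tabulate : ∀ {A : Set} {n} (p : A → Bool) (f : Fin n → A) →
  length (filterᵇ p (tabulate f)) ≡ ∑[ i < n ] χ (p (f i))
length-filterᵇ-tabulate {n = zero}  p f = refl
length-filterᵇ-tabulate {n = suc n} p f with p (f zero)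
... | true  = cong suc (length-filterᵇ-tabulate p (f ∘ suc))
... | false = length-filterᵇ-tabulate p (f ∘ suc)

count≡∑χ : ∀ {n} (p : Fin n → Bool) → count p ≡ ∑[ x < n ] χ (p x)
count≡∑χ p = length-filterᵇ-tabulate p (λ x → x)

∑-≥-term : ∀ {n} (f : Fin n → ℕ) x → f x ≤ ∑[ y < n ] f y
∑-≥-term f zero    = m≤m+n _ _
∑-≥-term f (suc x) = ≤-trans (∑-≥-term (f ∘ suc) x) (m≤n+m _ _)

∑-≥-two-terms : ∀ {n} (f : Fin n → ℕ) {x y} → x ≢ y → f x + f y ≤ ∑[ z < n ] f z
∑-≥-two-terms f {zero}  {zero}  x≢y = ⊥-elim (x≢y refl)
∑-≥-two-terms f {zero}  {suc y} _   = +-monoʳ-≤ (f zero) (∑-≥-term (f ∘ suc) y)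
∑-≥-two-terms f {suc x} {zero}  _   =
  ≤-trans (≤-reflexive (+-comm (f (suc x)) (f zero))) (+-monoʳ-≤ (f zero) (∑-≥-term (f ∘ suc) x))
∑-≥-two-terms f {suc x} {suc y} x≢y =
  ≤-trans (∑-≥-two-terms (f ∘ suc) (x≢y ∘ cong suc)) (m≤n+m _ _)

∑-single : ∀ {n} (f : Fin n → ℕ) x → (∀ y → y ≢ x → f y ≡ 0) → ∑[ y < n ] f y ≡ f x
∑-single {suc n} f zero    others =
  trans (cong (f zero +_) (trans (sum-cong-≗ (λ y → others (suc y) λ ())) (sum-replicate-zero n)))
        (+-identityʳ (f zero))
∑-single {suc n} f (suc x) others =
  trans (cong (_+ ∑[ y < n ] f (suc y)) (others zero λ ()))
        (∑-single (f ∘ suc) x (λ y y≢x → others (suc y) (y≢x ∘ Fin.suc-injective)))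

∑χ-witness : ∀ {n} (p : Fin n → Bool) → 1 ≤ ∑[ x < n ] χ (p x) → ∃ λ x → p x ≡ true
∑χ-witness {suc n} p pos with p zero in eq
... | true  = zero , eq
... | false with ∑χ-witness (p ∘ suc) pos
... | x , px = suc x , px

count-cong : ∀ {n} {p q : Fin n → Bool} → (∀ x → p x ≡ q x) → count p ≡ count q
count-cong {p = p} {q} p≗q =
  trans (count≡∑χ p) (trans (sum-cong-≗ (cong χ ∘ p≗q)) (sym (count≡∑χ q)))

count-pos : ∀ {n} (p : Fin n → Bool) {x} → p x ≡ true → 1 ≤ count p
count-pos p {x} px =
  ≤-trans (≤-reflexive (cong χ (sym px)))
          (≤-trans (∑-≥-term (χ ∘ p) x) (≤-reflexive (sym (count≡∑χ p))))

count-witness : ∀ {n} (p : Fin n → Bool) → 1 ≤ count p → ∃ λ x → p x ≡ true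
count-witness p pos = ∑χ-witness p (subst (1 ≤_) (count≡∑χ p) pos)

count≤1⇒unique : ∀ {n} (p : Fin n → Bool) {x y} → count p ≤ 1 → p x ≡ true → p y ≡ true → x ≡ y
count≤1⇒unique p {x} {y} atMost1 px py with x ≟ y
... | yes x≡y = x≡y
... | no  x≢y = ⊥-elim (<⇒≱ two≤count (subst (_≤ 1) (count≡∑χ p) atMost1))
  where
  two≤count : 2 ≤ ∑[ z < _ ] χ (p z)
  two≤count = ≤-trans (≤-reflexive (cong₂ (λ a b → χ a + χ b) (sym px) (sym py)))
                      (∑-≥-two-terms (χ ∘ p) x≢y)

unique⇒count≤1 : ∀ {n} (p : Fin n → Bool) →
  (∀ x y → p x ≡ true → p y ≡ true → x ≡ y) → count p ≤ 1
unique⇒count≤1 p unique with 1 ≤? count p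
... | no  count≱1 = ≤-trans (≤-pred (≰⇒> count≱1)) z≤n
... | yes pos with count-witness p pos
... | x , px = ≤-reflexive (trans (count≡∑χ p) (trans (∑-single (χ ∘ p) x others) (cong χ px)))
  where
  others : ∀ y → y ≢ x → χ (p y) ≡ 0
  others y y≢x with p y in py
  ... | true  = ⊥-elim (y≢x (unique y x py px))
  ... | false = refl

count-none : ∀ {n} (p : Fin n → Bool) → (∀ x → p x ≡ false) → count p ≡ 0
count-none {n} p never = trans (count≡∑χ p) (trans (sum-cong-≗ (cong χ ∘ never)) (sum-replicate-zero n))

count-≟ : ∀ {n} (x : Fin n) (p : Fin n → Bool) → count (λ y → isYes (x ≟ y) ∧ p y) ≡ χ (p x)
count-≟ x p = begin
  count (λ y → isYes (x ≟ y) ∧ p y)          ≡⟨ count≡∑χ (λ y → isYes (x ≟ y) ∧ p y) ⟩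
  ∑[ y < _ ] χ (isYes (x ≟ y) ∧ p y)         ≡⟨ ∑-single (λ y → χ (isYes (x ≟ y) ∧ p y)) x others ⟩
  χ (isYes (x ≟ x) ∧ p x)                    ≡⟨ cong (λ a → χ (a ∧ p x)) (isYes-refl x) ⟩
  χ (p x)                                    ∎
  where
  open ≡-Reasoning
  others : ∀ y → y ≢ x → χ (isYes (x ≟ y) ∧ p y) ≡ 0
  others y y≢x with x ≟ y
  ... | yes x≡y = ⊥-elim (y≢x (sym x≡y))
  ... | no  _   = refl

count-split : ∀ {n} (p q r : Fin n → Bool) → (∀ x → χ (p x) ≡ χ (q x) + χ (r x)) →
  count p ≡ count q + count r
count-split p q r split = begin
  count p                                        ≡⟨ count≡∑χ p ⟩
  ∑[ x < _ ] χ (p x)                             ≡⟨ sum-cong-≗ split ⟩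
  ∑[ x < _ ] (χ (q x) + χ (r x))                 ≡⟨ ∑-distrib-+ (χ ∘ q) (χ ∘ r) ⟩
  ∑[ x < _ ] χ (q x) + ∑[ x < _ ] χ (r x)        ≡⟨ cong₂ _+_ (count≡∑χ q) (count≡∑χ r) ⟨
  count q + count r                              ∎
  where open ≡-Reasoning

count-∧ˡ : ∀ {n} a (p : Fin n → Bool) → count (λ x → a ∧ p x) ≡ χ a * count p
count-∧ˡ a p = begin
  count (λ x → a ∧ p x)           ≡⟨ count≡∑χ (λ x → a ∧ p x) ⟩
  ∑[ x < _ ] χ (a ∧ p x)          ≡⟨ sum-cong-≗ (χ-∧ a ∘ p) ⟩
  ∑[ x < _ ] (χ a * χ (p x))      ≡⟨ *-distribˡ-sum (χ a) (χ ∘ p) ⟨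
  χ a * ∑[ x < _ ] χ (p x)        ≡⟨ cong (χ a *_) (count≡∑χ p) ⟨
  χ a * count p                   ∎
  where open ≡-Reasoning

∑-count-comm : ∀ {m n} (R : Fin m → Fin n → Bool) →
  ∑[ x < m ] count (R x) ≡ ∑[ y < n ] count (λ x → R x y)
∑-count-comm R = begin
  ∑[ x < _ ] count (R x)                    ≡⟨ sum-cong-≗ (count≡∑χ ∘ R) ⟩
  ∑[ x < _ ] ∑[ y < _ ] χ (R x y)           ≡⟨ ∑-comm (λ x y → χ (R x y)) ⟩
  ∑[ y < _ ] ∑[ x < _ ] χ (R x y)           ≡⟨ sum-cong-≗ (λ y → count≡∑χ (λ x → R x y)) ⟨
  ∑[ y < _ ] count (λ x → R x y)            ∎
  where open ≡-Reasoning

∑-count-∧-const : ∀ {m n} (P : Fin m → Bool) (R : Fin m → Fin n → Bool) r →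
  (∀ x → P x ≡ true → count (R x) ≡ r) → ∑[ x < m ] count (λ y → P x ∧ R x y) ≡ r * count P
∑-count-∧-const P R r constant = begin
  ∑[ x < _ ] count (λ y → P x ∧ R x y)      ≡⟨ sum-cong-≗ (λ x → trans (count-∧ˡ (P x) (R x)) (weight x)) ⟩
  ∑[ x < _ ] (r * χ (P x))                  ≡⟨ *-distribˡ-sum r (χ ∘ P) ⟨
  r * ∑[ x < _ ] χ (P x)                    ≡⟨ cong (r *_) (count≡∑χ P) ⟨
  r * count P                               ∎
  where
  open ≡-Reasoning
  weight : ∀ x → χ (P x) * count (R x) ≡ r * χ (P x)
  weight x with P x in Px
  ... | true  = trans (+-identityʳ _) (trans (constant x Px) (sym (*-identityʳ r)))
  ... | false = sym (*-zeroʳ r)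

count-split₃ : ∀ {n} (p q r s : Fin n → Bool) → (∀ x → χ (p x) ≡ χ (q x) + χ (r x) + χ (s x)) →
  count p ≡ count q + count r + count s
count-split₃ p q r s split = begin
  count p
    ≡⟨ count≡∑χ p ⟩
  ∑[ x < _ ] χ (p x)
    ≡⟨ sum-cong-≗ split ⟩
  ∑[ x < _ ] (χ (q x) + χ (r x) + χ (s x))
    ≡⟨ ∑-distrib-+ (λ x → χ (q x) + χ (r x)) (χ ∘ s) ⟩
  ∑[ x < _ ] (χ (q x) + χ (r x)) + ∑[ x < _ ] χ (s x)
    ≡⟨ cong (_+ ∑[ x < _ ] χ (s x)) (∑-distrib-+ (χ ∘ q) (χ ∘ r)) ⟩
  ∑[ x < _ ] χ (q x) + ∑[ x < _ ] χ (r x) + ∑[ x < _ ] χ (s x)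
    ≡⟨ cong₂ _+_ (cong₂ _+_ (count≡∑χ q) (count≡∑χ r)) (count≡∑χ s) ⟨
  count q + count r + count s
    ∎
  where open ≡-Reasoning

module Walks {n : ℕ} (G : Graph n) where

  -- Propositional wrappers of the Boolean relations: unlike those, they
  -- determine their indices, which can therefore be left implicit.
  record Adj (x y : Fin n) : Set where
    constructor mkAdj
    field adj≡true : adj G x y ≡ true

  record Reach (k : ℕ) (x y : Fin n) : Set where
    constructor mkReach
    field reach≡true : reach G k x y ≡ true

  record Dist (i : ℕ) (x y : Fin n) : Set where
    constructor mkDist
    field atDist≡true : atDist G i x y ≡ true

  open Adj public
  open Reach public
  open Dist public

  Adj-sym : ∀ {x y} → Adj x y → Adj y x
  Adj-sym {x} {y} (mkAdj a) = mkAdj (trans (adj-sym G y x) a)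

  Adj⇒≢ : ∀ {x y} → Adj x y → x ≢ y
  Adj⇒≢ {x} (mkAdj a) refl with trans (sym a) (adj-irrefl G x)
  ... | ()

  reach-refl : ∀ x → Reach 0 x x
  reach-refl x = mkReach (isYes-refl x)

  Reach0⇒≡ : ∀ {x y} → Reach 0 x y → x ≡ y
  Reach0⇒≡ (mkReach r) = isYes-≡ r

  reach-weaken : ∀ {k x y} → Reach k x y → Reach (suc k) x y
  reach-weaken (mkReach r) = mkReach (∨-trueˡ _ r)

  reach-cons : ∀ {k x z y} → Adj x z → Reach k z y → Reach (suc k) x y
  reach-cons {k} {x} {z} {y} (mkAdj a) (mkReach r) =
    mkReach (∨-trueʳ (reach G k x y)
      (any-true⁺ (λ w → adj G x w ∧ reach G k w y) (∈-allFin z) (∧-true⁺ a r)))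

  reach-uncons : ∀ {k x y} → Reach (suc k) x y → Reach k x y ⊎ ∃ λ z → Adj x z × Reach k z y
  reach-uncons {k} {x} {y} (mkReach r) with ∨-true⁻ {reach G k x y} r
  ... | inj₁ shorter = inj₁ (mkReach shorter)
  ... | inj₂ step with any-true⁻ _ (allFin n) step
  ... | z , xz∧zy with ∧-true⁻ {adj G x z} xz∧zy
  ... | xz , zy = inj₂ (z , mkAdj xz , mkReach zy)

  reach-mono : ∀ {k l x y} → k ≤ l → Reach k x y → Reach l x y
  reach-mono {zero}  {zero}  z≤n r = r
  reach-mono {zero}  {suc l} z≤n r = reach-weaken (reach-mono z≤n r)
  reach-mono {suc k} {suc l} (s≤s k≤l) r with reach-uncons r
  ... | inj₁ r′            = reach-weaken (reach-mono k≤l r′)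
  ... | inj₂ (z , xz , zy) = reach-cons xz (reach-mono k≤l zy)

  Dist⇒Reach : ∀ {i x y} → Dist i x y → Reach i x y
  Dist⇒Reach {zero}  (mkDist d) = mkReach d
  Dist⇒Reach {suc i} (mkDist d) = mkReach (proj₁ (∧-true⁻ d))

  Dist-minimal : ∀ {i j x y} → Dist i x y → j < i → ¬ Reach j x y
  Dist-minimal {suc i} {x = x} {y} (mkDist d) (s≤s j≤i) r =
    not-¬ (sym (reach≡true (reach-mono j≤i r))) (sym (proj₂ (∧-true⁻ {reach G (suc i) x y} d)))

  Dist≤Reach : ∀ {i k x y} → Dist i x y → Reach k x y → i ≤ k
  Dist≤Reach {i} {k} d r with i ≤? k
  ... | yes i≤k = i≤k
  ... | no  i≰k = ⊥-elim (Dist-minimal d (≰⇒> i≰k) r)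

  Dist-unique : ∀ {i j x y} → Dist i x y → Dist j x y → i ≡ j
  Dist-unique dᵢ dⱼ = ≤-antisym (Dist≤Reach dᵢ (Dist⇒Reach dⱼ)) (Dist≤Reach dⱼ (Dist⇒Reach dᵢ))

  Reach⇒Dist : ∀ {k x y} → Reach k x y → ∃ λ i → i ≤ k × Dist i x y
  Reach⇒Dist {zero} (mkReach r) = 0 , z≤n , mkDist r
  Reach⇒Dist {suc k} {x} {y} (mkReach r) = bySubwalk (reach G k x y) refl
    where
    bySubwalk : ∀ b → reach G k x y ≡ b → ∃ λ i → i ≤ suc k × Dist i x y
    bySubwalk true  shorter with Reach⇒Dist (mkReach shorter)
    ... | i , i≤k , d = i , m≤n⇒m≤1+n i≤k , d
    bySubwalk false shorter = suc k , ≤-refl , mkDist (∧-true⁺ r (cong not shorter))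

  Dist-intro : ∀ {i x y} → Reach i x y → (∀ {j} → j < i → ¬ Reach j x y) → Dist i x y
  Dist-intro r noShorter with Reach⇒Dist r
  ... | j , j≤i , d with m≤n⇒m<n∨m≡n j≤i
  ... | inj₁ j<i  = ⊥-elim (noShorter j<i (Dist⇒Reach d))
  ... | inj₂ refl = d

  Dist-refl : ∀ x → Dist 0 x x
  Dist-refl x = mkDist (isYes-refl x)

  Dist0⇒≡ : ∀ {x y} → Dist 0 x y → x ≡ y
  Dist0⇒≡ d = Reach0⇒≡ (Dist⇒Reach d)

  Adj⇒Dist1 : ∀ {x y} → Adj x y → Dist 1 x y
  Adj⇒Dist1 xy = Dist-intro (reach-cons xy (reach-refl _)) λ { (s≤s z≤n) r → Adj⇒≢ xy (Reach0⇒≡ r) }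

  Dist-pred : ∀ {i x y} → Dist (suc i) x y → ∃ λ z → Adj x z × Dist i z y
  Dist-pred d with reach-uncons (Dist⇒Reach d)
  ... | inj₁ r = ⊥-elim (Dist-minimal d ≤-refl r)
  ... | inj₂ (z , xz , zy) = z , xz , Dist-intro zy (λ j<i r → Dist-minimal d (s≤s j<i) (reach-cons xz r))

  Dist-neighbour : ∀ {i j x z y} → Adj x z → Dist i x y → Dist j z y → j ≤ suc i
  Dist-neighbour xz dx dz = Dist≤Reach dz (reach-cons (Adj-sym xz) (Dist⇒Reach dx))

module DistanceRegularGraph {n : ℕ} (G : Graph n) (b c : ℕ → ℕ)
  (b-spec : ∀ i (x y : Fin n) → atDist G i x y ≡ true →
            count (λ z → adj G x z ∧ atDist G (suc i) z y) ≡ b i)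
  (c-spec : ∀ i (x y : Fin n) → atDist G (suc i) x y ≡ true →
            count (λ z → adj G x z ∧ atDist G i z y) ≡ c (suc i)) where

  open Walks G

  k : ℕ
  k = b 0

  degree : ∀ x → count (adj G x) ≡ k
  degree x = trans (count-cong atDist1) (b-spec 0 x x (atDist≡true (Dist-refl x)))
    where
    atDist1 : ∀ z → adj G x z ≡ (adj G x z ∧ atDist G 1 z x)
    atDist1 z with adj G x z in xz
    ... | true  = sym (atDist≡true (Adj⇒Dist1 (Adj-sym (mkAdj xz))))
    ... | false = refl

  b-pos : ∀ {m x y} j → Dist m x y → j < m → 1 ≤ b j
  b-pos {suc m} {x} {y} j h (s≤s j≤m) with Dist-pred h
  ... | z , xz , hz with m≤n⇒m<n∨m≡n j≤m
  ...   | inj₁ j<m  = b-pos j hz j<m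
  ...   | inj₂ refl = subst (1 ≤_) (b-spec j z y (atDist≡true hz))
      (count-pos (λ w → adj G z w ∧ atDist G (suc j) w y) (∧-true⁺ (adj≡true (Adj-sym xz)) (atDist≡true h)))

  module Layers (d : ℕ) (diam : HasDiameter G (3 + d)) (o : Fin n) where

    D : ℕ
    D = 3 + d

    L : ℕ → Fin n → Bool
    L j v = atDist G j v o

    size : ℕ → ℕ
    size j = count (L j)

    nbrs : ℕ → Fin n → ℕ
    nbrs j e = count (λ z → adj G e z ∧ L j z)

    nbrs-up : ∀ {i e} → Dist i e o → nbrs (suc i) e ≡ b i
    nbrs-up {i} {e} (mkDist h) = b-spec i e o h

    nbrs-down : ∀ {i e} → Dist (suc i) e o → nbrs i e ≡ c (suc i)
    nbrs-down {i} {e} (mkDist h) = c-spec i e o h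

    level : Fin n → ℕ
    level v = proj₁ (proj₁ diam v o)

    level≤D : ∀ v → level v ≤ D
    level≤D v = proj₁ (proj₂ (proj₁ diam v o))

    Dist-level : ∀ v → Dist (level v) v o
    Dist-level v = mkDist (proj₂ (proj₂ (proj₁ diam v o)))

    L-≢ : ∀ {i v} j → Dist i v o → i ≢ j → L j v ≡ false
    L-≢ {i} {v} j h i≢j with L j v in Ljv
    ... | true  = ⊥-elim (i≢j (Dist-unique h (mkDist Ljv)))
    ... | false = refl

    L-beyond : ∀ j v → D < j → L j v ≡ false
    L-beyond j v D<j = L-≢ j (Dist-level v) (<⇒≢ (≤-<-trans (level≤D v) D<j))

    nbrs-far : ∀ {i e} j → Dist i e o → (2 + i ≤ j ⊎ 2 + j ≤ i) → nbrs j e ≡ 0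
    nbrs-far {i} {e} j h far = count-none (λ z → adj G e z ∧ L j z) notFar
      where
      notFar : ∀ z → (adj G e z ∧ L j z) ≡ false
      notFar z with adj G e z in ez | L j z in Ljz
      ... | false | _     = refl
      ... | true  | false = refl
      ... | true  | true  = ⊥-elim (impossible far)
        where
        impossible : 2 + i ≤ j ⊎ 2 + j ≤ i → ⊥
        impossible (inj₁ above) = <⇒≱ above (Dist-neighbour (mkAdj ez) h (mkDist Ljz))
        impossible (inj₂ below) = <⇒≱ below (Dist-neighbour (Adj-sym (mkAdj ez)) (mkDist Ljz) h)

    nbrs-beyond : ∀ j e → D < j → nbrs j e ≡ 0
    nbrs-beyond j e D<j = count-none (λ z → adj G e z ∧ L j z)
      (λ z → trans (cong (adj G e z ∧_) (L-beyond j z D<j)) (∧-zeroʳ (adj G e z)))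

    neighbour-level : ∀ {i e z} → Adj e z → Dist (suc i) e o →
      Dist i z o ⊎ Dist (suc i) z o ⊎ Dist (2 + i) z o
    neighbour-level {i} {e} {z} ez h = within (level z) (Dist-level z) below above
      where
      below : level z ≤ 2 + i
      below = Dist-neighbour ez h (Dist-level z)
      above : i ≤ level z
      above = ≤-pred (Dist-neighbour (Adj-sym ez) (Dist-level z) h)
      within : ∀ j → Dist j z o → j ≤ 2 + i → i ≤ j → Dist i z o ⊎ Dist (suc i) z o ⊎ Dist (2 + i) z o
      within j hj j≤ i≤ with m≤n⇒m<n∨m≡n j≤
      ... | inj₂ refl = inj₂ (inj₂ hj)
      ... | inj₁ (s≤s j≤1+i) with m≤n⇒m<n∨m≡n j≤1+i
      ...   | inj₂ refl = inj₂ (inj₁ hj)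
      ...   | inj₁ (s≤s j≤i) with ≤-antisym j≤i i≤
      ...     | refl = inj₁ hj

    degree-split : ∀ {i e} → Dist (suc i) e o → k ≡ nbrs i e + nbrs (suc i) e + nbrs (2 + i) e
    degree-split {i} {e} h = trans (sym (degree e)) (count-split₃ (adj G e) (nbrAt i) (nbrAt (suc i)) (nbrAt (2 + i)) split)
      where
      nbrAt : ℕ → Fin n → Bool
      nbrAt j z = adj G e z ∧ L j z
      i<2+i : i < 2 + i
      i<2+i = m≤n⇒m≤1+n (n<1+n i)
      split : ∀ z → χ (adj G e z) ≡ χ (nbrAt i z) + χ (nbrAt (suc i) z) + χ (nbrAt (2 + i) z)
      split z with adj G e z in ez
      ... | false = refl
      ... | true with neighbour-level (mkAdj ez) h
      ...   | inj₁ hz =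
        sym (χ-cong₃ (atDist≡true hz) (L-≢ (suc i) hz (<⇒≢ (n<1+n i))) (L-≢ (2 + i) hz (<⇒≢ i<2+i)))
      ...   | inj₂ (inj₁ hz) =
        sym (χ-cong₃ (L-≢ i hz (>⇒≢ (n<1+n i))) (atDist≡true hz) (L-≢ (2 + i) hz (<⇒≢ (n<1+n (suc i)))))
      ...   | inj₂ (inj₂ hz) =
        sym (χ-cong₃ (L-≢ i hz (>⇒≢ i<2+i)) (L-≢ (suc i) hz (>⇒≢ (n<1+n (suc i)))) (atDist≡true hz))

    size-edge : ∀ i → b i * size i ≡ c (suc i) * size (suc i)
    size-edge i = begin
      b i * size i
        ≡⟨ ∑-count-∧-const (L i) (λ u v → adj G u v ∧ L (suc i) v) (b i) (λ u Liu → nbrs-up (mkDist Liu)) ⟨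
      ∑[ u < n ] count (λ v → L i u ∧ (adj G u v ∧ L (suc i) v))
        ≡⟨ ∑-count-comm (λ u v → L i u ∧ (adj G u v ∧ L (suc i) v)) ⟩
      ∑[ v < n ] count (λ u → L i u ∧ (adj G u v ∧ L (suc i) v))
        ≡⟨ sum-cong-≗ (λ v → count-cong (λ u → reverse u v)) ⟩
      ∑[ v < n ] count (λ u → L (suc i) v ∧ (adj G v u ∧ L i u))
        ≡⟨ ∑-count-∧-const (L (suc i)) (λ v u → adj G v u ∧ L i u) (c (suc i)) (λ v Lv → nbrs-down (mkDist Lv)) ⟩
      c (suc i) * size (suc i)
        ∎
      where
      open ≡-Reasoning
      reverse : ∀ u v → (L i u ∧ (adj G u v ∧ L (suc i) v)) ≡ (L (suc i) v ∧ (adj G v u ∧ L i u))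
      reverse u v = trans (∧-rotate (L i u) (adj G u v) (L (suc i) v))
                          (cong (λ a → L (suc i) v ∧ (a ∧ L i u)) (adj-sym G u v))

    b-pos-below-diameter : ∀ j → j < D → 1 ≤ b j
    b-pos-below-diameter j j<D with proj₂ diam
    ... | x , y , h = b-pos j (mkDist h) j<D

    level-inhabited : ∀ j → j ≤ D → ∃ λ v → Dist j v o
    level-inhabited zero    _   = o , Dist-refl o
    level-inhabited (suc j) j<D with level-inhabited j (<⇒≤ j<D)
    ... | v , hv with count-witness (λ z → adj G v z ∧ L (suc j) z)
                                    (subst (1 ≤_) (sym (nbrs-up hv)) (b-pos-below-diameter j j<D))
    ...   | z , vz∧Lz = z , mkDist (proj₂ (∧-true⁻ {adj G v z} vz∧Lz))

    size-pos : ∀ j → j ≤ D → 1 ≤ size j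
    size-pos j j≤D with level-inhabited j j≤D
    ... | v , hv = count-pos (L j) (atDist≡true hv)

    c-pos : ∀ j → suc j ≤ D → 1 ≤ c (suc j)
    c-pos j j<D with level-inhabited (suc j) j<D
    ... | v , hv with Dist-pred hv
    ...   | z , vz , hz =
      subst (1 ≤_) (nbrs-down hv) (count-pos (λ w → adj G v w ∧ L j w) (∧-true⁺ (adj≡true vz) (atDist≡true hz)))

    b<k : ∀ i → suc i ≤ D → b (suc i) < k
    b<k i i<D with level-inhabited (suc i) i<D
    ... | v , hv = begin-strict
      b (suc i)                                     <⟨ +-monoˡ-≤ (b (suc i)) (≤-trans (c-pos i i<D) (m≤m+n _ _)) ⟩
      c (suc i) + nbrs (suc i) v + b (suc i)        ≡⟨ cong₂ (λ x y → x + nbrs (suc i) v + y) (nbrs-down hv) (nbrs-up hv) ⟨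
      nbrs i v + nbrs (suc i) v + nbrs (2 + i) v    ≡⟨ degree-split hv ⟨
      k                                             ∎
      where open ≤-Reasoning

    data TopLevel : ℕ → Set where
      top   : TopLevel (3 + d)
      top-1 : TopLevel (2 + d)
      top-2 : TopLevel (1 + d)
      lower : ∀ {i} → i ≤ d → TopLevel i

    topLevel : ∀ {i} → i ≤ D → TopLevel i
    topLevel i≤D with m≤n⇒m<n∨m≡n i≤D
    ... | inj₂ refl = top
    ... | inj₁ (s≤s i≤2+d) with m≤n⇒m<n∨m≡n i≤2+d
    ...   | inj₂ refl = top-1
    ...   | inj₁ (s≤s i≤1+d) with m≤n⇒m<n∨m≡n i≤1+d
    ...     | inj₂ refl = top-2
    ...     | inj₁ (s≤s i≤d) = lower i≤d

    module Antipodality (antipodal : Antipodal G D) where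
      open IsEquivalence antipodal using () renaming (sym to ~-sym; trans to ~-trans)

      top-close⇒≡ : ∀ {y z} → Dist D y o → Dist D z o → Reach 2 y z → y ≡ z
      top-close⇒≡ {y} {z} hy hz r with y ≟ z
      ... | yes y≡z = y≡z
      ... | no  y≢z with ~-trans (inj₂ (atDist≡true hy)) (~-sym (inj₂ (atDist≡true hz)))
      ...   | inj₁ y≡z  = ⊥-elim (y≢z y≡z)
      ...   | inj₂ far  = ⊥-elim (<⇒≱ (s≤s (s≤s (s≤s z≤n))) (Dist≤Reach {D} (mkDist far) r))

      nbrs-top : ∀ {e} → Dist D e o → nbrs D e ≡ 0
      nbrs-top {e} he = count-none (λ z → adj G e z ∧ L D z) noTopNeighbour
        where
        noTopNeighbour : ∀ z → (adj G e z ∧ L D z) ≡ false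
        noTopNeighbour z with adj G e z in ez | L D z in Lz
        ... | false | _     = refl
        ... | true  | false = refl
        ... | true  | true  =
          ⊥-elim (Adj⇒≢ (mkAdj ez) (top-close⇒≡ he (mkDist Lz) (reach-weaken (reach-cons (mkAdj ez) (reach-refl z)))))

      b[D-1]≡1 : b (2 + d) ≡ 1
      b[D-1]≡1 = atVertex (proj₂ (level-inhabited (2 + d) (n≤1+n _)))
        where
        atVertex : ∀ {v} → Dist (2 + d) v o → b (2 + d) ≡ 1
        atVertex {v} hv = trans (sym (nbrs-up hv)) (≤-antisym atMostOne atLeastOne)
          where
          atMostOne : nbrs D v ≤ 1
          atMostOne = unique⇒count≤1 (λ z → adj G v z ∧ L D z) λ y z vy∧Ly vz∧Lz →
            let (vy , Ly) = ∧-true⁻ {adj G v y} vy∧Ly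
                (vz , Lz) = ∧-true⁻ {adj G v z} vz∧Lz
            in top-close⇒≡ (mkDist Ly) (mkDist Lz)
                           (reach-cons (Adj-sym (mkAdj vy)) (reach-cons (mkAdj vz) (reach-refl z)))
          atLeastOne : 1 ≤ nbrs D v
          atLeastOne = subst (1 ≤_) (sym (nbrs-up hv)) (b-pos-below-diameter (2 + d) ≤-refl)

      c[D]≡k : c D ≡ k
      c[D]≡k = atVertex (proj₂ (level-inhabited D ≤-refl))
        where
        atVertex : ∀ {v} → Dist D v o → c D ≡ k
        atVertex {v} hv = sym (begin
          k                                          ≡⟨ degree-split hv ⟩
          nbrs (2 + d) v + nbrs D v + nbrs (4 + d) v
            ≡⟨ cong₂ _+_ (cong₂ _+_ (nbrs-down hv) (nbrs-top hv)) (nbrs-beyond (4 + d) v ≤-refl) ⟩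
          c D + 0 + 0                                ≡⟨ +-identityʳ (c D + 0) ⟩
          c D + 0                                    ≡⟨ +-identityʳ (c D) ⟩
          c D                                        ∎)
          where open ≡-Reasoning

      size[D-1]≡k*size[D] : size (2 + d) ≡ k * size D
      size[D-1]≡k*size[D] = begin
        size (2 + d)              ≡⟨ +-identityʳ _ ⟨
        1 * size (2 + d)          ≡⟨ cong (_* size (2 + d)) b[D-1]≡1 ⟨
        b (2 + d) * size (2 + d)  ≡⟨ size-edge (2 + d) ⟩
        c D * size D              ≡⟨ cong (_* size D) c[D]≡k ⟩
        k * size D                ∎
        where open ≡-Reasoning

    module PerfectCodeCounting (C : Fin n → Bool) (perfect : PerfectCode G C) where

      cover : ℕ → Fin n → ℕ
      cover j e = count (λ v → inClosedNbhd G e v ∧ L j v)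

      codeSize : ℕ → ℕ
      codeSize j = count (λ e → C e ∧ L j e)

      ∑code : (Fin n → ℕ) → ℕ
      ∑code f = ∑[ e < n ] (χ (C e) * f e)

      cover≡self+nbrs : ∀ j e → cover j e ≡ χ (L j e) + nbrs j e
      cover≡self+nbrs j e =
        trans (count-split (λ v → inClosedNbhd G e v ∧ L j v) (λ v → isYes (e ≟ v) ∧ L j v) (λ v → adj G e v ∧ L j v) split)
              (cong (_+ nbrs j e) (count-≟ e (L j)))
        where
        split : ∀ v → χ (inClosedNbhd G e v ∧ L j v) ≡ χ (isYes (e ≟ v) ∧ L j v) + χ (adj G e v ∧ L j v)
        split v with e ≟ v
        ... | yes refl = trans (sym (+-identityʳ _)) (cong (λ a → χ (L j v) + χ (a ∧ L j v)) (sym (adj-irrefl G v)))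
        ... | no  _    = refl

      size≡∑code-cover : ∀ j → size j ≡ ∑code (cover j)
      size≡∑code-cover j = begin
        size j
          ≡⟨ +-identityʳ _ ⟨
        1 * size j
          ≡⟨ ∑-count-∧-const (L j) (λ v e → C e ∧ inClosedNbhd G e v) 1 (λ v _ → perfect v) ⟨
        ∑[ v < n ] count (λ e → L j v ∧ (C e ∧ inClosedNbhd G e v))
          ≡⟨ ∑-count-comm (λ v e → L j v ∧ (C e ∧ inClosedNbhd G e v)) ⟩
        ∑[ e < n ] count (λ v → L j v ∧ (C e ∧ inClosedNbhd G e v))
          ≡⟨ sum-cong-≗ (λ e → count-cong (λ v → regroup (L j v) (C e) (inClosedNbhd G e v))) ⟩
        ∑[ e < n ] count (λ v → C e ∧ (inClosedNbhd G e v ∧ L j v))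
          ≡⟨ sum-cong-≗ (λ e → count-∧ˡ (C e) (λ v → inClosedNbhd G e v ∧ L j v)) ⟩
        ∑code (cover j)
          ∎
        where
        open ≡-Reasoning
        regroup : ∀ a b c → a ∧ (b ∧ c) ≡ b ∧ (c ∧ a)
        regroup a b c = trans (∧-comm a (b ∧ c)) (∧-assoc b c a)

      ∑code-cong : ∀ {f g} → (∀ e → C e ≡ true → f e ≡ g e) → ∑code f ≡ ∑code g
      ∑code-cong {f} {g} f≡g = sum-cong-≗ onCode
        where
        onCode : ∀ e → χ (C e) * f e ≡ χ (C e) * g e
        onCode e with C e in Ce
        ... | true  = cong (_+ 0) (f≡g e Ce)
        ... | false = refl

      ∑code-+ : ∀ f g → ∑code (λ e → f e + g e) ≡ ∑code f + ∑code g
      ∑code-+ f g = trans (sum-cong-≗ (λ e → *-distribˡ-+ (χ (C e)) (f e) (g e)))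
                          (∑-distrib-+ (λ e → χ (C e) * f e) (λ e → χ (C e) * g e))

      ∑code-* : ∀ m f → ∑code (λ e → m * f e) ≡ m * ∑code f
      ∑code-* m f = trans (sum-cong-≗ (λ e → x∙yz≈y∙xz (χ (C e)) m (f e)))
                          (sym (*-distribˡ-sum m (λ e → χ (C e) * f e)))

      ∑code-level : ∀ j → ∑code (χ ∘ L j) ≡ codeSize j
      ∑code-level j = trans (sum-cong-≗ (λ e → sym (χ-∧ (C e) (L j e)))) (sym (count≡∑χ (λ e → C e ∧ L j e)))

      χL-self : ∀ {i e} → Dist i e o → χ (L i e) ≡ 1
      χL-self h = cong χ (atDist≡true h)

      χL-≢ : ∀ {i e} j → Dist i e o → i ≢ j → χ (L j e) ≡ 0
      χL-≢ j h i≢j = cong χ (L-≢ j h i≢j)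

      cover-same : ∀ {i e} → Dist i e o → cover i e ≡ 1 + nbrs i e
      cover-same {i} {e} h = trans (cover≡self+nbrs i e) (cong (_+ nbrs i e) (χL-self h))

      cover-up : ∀ {i e} → Dist i e o → cover (suc i) e ≡ b i
      cover-up {i} {e} h =
        trans (cover≡self+nbrs (suc i) e) (cong₂ _+_ (χL-≢ (suc i) h (<⇒≢ (n<1+n i))) (nbrs-up h))

      cover-down : ∀ {i e} → Dist (suc i) e o → cover i e ≡ c (suc i)
      cover-down {i} {e} h =
        trans (cover≡self+nbrs i e) (cong₂ _+_ (χL-≢ i h (>⇒≢ (n<1+n i))) (nbrs-down h))

      cover-far : ∀ {i e} j → Dist i e o → (2 + i ≤ j ⊎ 2 + j ≤ i) → cover j e ≡ 0
      cover-far {i} {e} j h far =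
        trans (cover≡self+nbrs j e) (cong₂ _+_ (χL-≢ j h (apart far)) (nbrs-far j h far))
        where
        apart : 2 + i ≤ j ⊎ 2 + j ≤ i → i ≢ j
        apart (inj₁ above) = <⇒≢ (≤-trans (n≤1+n _) above)
        apart (inj₂ below) = >⇒≢ (≤-trans (n≤1+n _) below)

      codewords-cover-disjoint : ∀ {x y v} → C x ≡ true → C y ≡ true →
        inClosedNbhd G x v ≡ true → inClosedNbhd G y v ≡ true → x ≡ y
      codewords-cover-disjoint {v = v} Cx Cy xv yv =
        count≤1⇒unique (λ e → C e ∧ inClosedNbhd G e v) (≤-reflexive (perfect v)) (∧-true⁺ Cx xv) (∧-true⁺ Cy yv)

      inClosedNbhd-self : ∀ x → inClosedNbhd G x x ≡ true
      inClosedNbhd-self x = ∨-trueˡ _ (isYes-refl x)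

      inClosedNbhd-adj : ∀ {x y} → Adj x y → inClosedNbhd G x y ≡ true
      inClosedNbhd-adj {x} {y} xy = ∨-trueʳ (isYes (x ≟ y)) (adj≡true xy)

      codewords-not-at-distance-1 : ∀ {x y} → C x ≡ true → C y ≡ true → ¬ Dist 1 x y
      codewords-not-at-distance-1 Cx Cy h with Dist-pred h
      ... | z , xz , hz with Dist0⇒≡ hz
      ...   | refl = Adj⇒≢ xz (codewords-cover-disjoint Cx Cy (inClosedNbhd-adj xz) (inClosedNbhd-self _))

      codewords-not-at-distance-2 : ∀ {x y} → C x ≡ true → C y ≡ true → ¬ Dist 2 x y
      codewords-not-at-distance-2 {x} Cx Cy h with Dist-pred h
      ... | m , xm , hm with Dist-pred hm
      ...   | z , mz , hz with Dist0⇒≡ hz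
      ...     | refl with codewords-cover-disjoint Cx Cy (inClosedNbhd-adj xm) (inClosedNbhd-adj (Adj-sym mz))
      ...       | refl with Dist-unique h (Dist-refl x)
      ...         | ()

      module CodewordAtBase (Co : C o ≡ true) where

        codeSize[2]≡0 : codeSize 2 ≡ 0
        codeSize[2]≡0 = count-none (λ e → C e ∧ L 2 e) notAtDistance2
          where
          notAtDistance2 : ∀ e → (C e ∧ L 2 e) ≡ false
          notAtDistance2 e with C e in Ce | L 2 e in L2e
          ... | false | _     = refl
          ... | true  | false = refl
          ... | true  | true  = ⊥-elim (codewords-not-at-distance-2 Ce Co (mkDist L2e))

        size[2]≡c₃*codeSize[3] : size 2 ≡ c 3 * codeSize 3
        size[2]≡c₃*codeSize[3] = begin
          size 2                    ≡⟨ size≡∑code-cover 2 ⟩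
          ∑code (cover 2)           ≡⟨ ∑code-cong (λ e Ce → byLevel Ce (Dist-level e)) ⟩
          ∑code (λ e → c 3 * χ (L 3 e)) ≡⟨ ∑code-* (c 3) (χ ∘ L 3) ⟩
          c 3 * ∑code (χ ∘ L 3)     ≡⟨ cong (c 3 *_) (∑code-level 3) ⟩
          c 3 * codeSize 3          ∎
          where
          open ≡-Reasoning
          notAt3 : ∀ {i e} → Dist i e o → i ≢ 3 → c 3 * χ (L 3 e) ≡ 0
          notAt3 h i≢3 = trans (cong (c 3 *_) (χL-≢ 3 h i≢3)) (*-zeroʳ (c 3))
          byLevel : ∀ {i e} → C e ≡ true → Dist i e o → cover 2 e ≡ c 3 * χ (L 3 e)
          byLevel {0} Ce h = trans (cover-far 2 h (inj₁ ≤-refl)) (sym (notAt3 h λ ()))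
          byLevel {1} Ce h = ⊥-elim (codewords-not-at-distance-1 Ce Co h)
          byLevel {2} Ce h = ⊥-elim (codewords-not-at-distance-2 Ce Co h)
          byLevel {3} Ce h = trans (cover-down h) (sym (trans (cong (c 3 *_) (χL-self h)) (*-identityʳ (c 3))))
          byLevel {suc (suc (suc (suc i)))} Ce h =
            trans (cover-far 2 h (inj₂ (s≤s (s≤s (s≤s (s≤s z≤n)))))) (sym (notAt3 h λ ()))

    module AntipodalPerfectCode (antipodal : Antipodal G D) (C : Fin n → Bool) (perfect : PerfectCode G C) where
      open Antipodality antipodal
      open PerfectCodeCounting C perfect

      cover[D]≡χ[D-1]+χ[D] : ∀ e → cover D e ≡ χ (L (2 + d) e) + χ (L D e)
      cover[D]≡χ[D-1]+χ[D] e = byLevel (Dist-level e) (topLevel (level≤D e))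
        where
        byLevel : ∀ {i} → Dist i e o → TopLevel i → cover D e ≡ χ (L (2 + d) e) + χ (L D e)
        byLevel h top =
          trans (trans (cover-same h) (cong suc (nbrs-top h)))
                (sym (cong₂ _+_ (χL-≢ (2 + d) h (>⇒≢ ≤-refl)) (χL-self h)))
        byLevel h top-1 =
          trans (trans (cover-up h) b[D-1]≡1)
                (sym (cong₂ _+_ (χL-self h) (χL-≢ D h (<⇒≢ ≤-refl))))
        byLevel h top-2 =
          trans (cover-far D h (inj₁ ≤-refl))
                (sym (cong₂ _+_ (χL-≢ (2 + d) h (<⇒≢ ≤-refl)) (χL-≢ D h (<⇒≢ (n≤1+n _)))))
        byLevel h (lower i≤d) =
          trans (cover-far D h (inj₁ (s≤s (s≤s i≤1+d))))
                (sym (cong₂ _+_ (χL-≢ (2 + d) h (<⇒≢ (s≤s i≤1+d))) (χL-≢ D h (<⇒≢ (s≤s i≤2+d)))))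
          where
          i≤1+d = m≤n⇒m≤1+n i≤d
          i≤2+d = m≤n⇒m≤1+n i≤1+d

      cover[D-1]+c·χ[D-1]≡k·cover[D]+b·χ[D-2] : ∀ e →
        cover (2 + d) e + c (2 + d) * χ (L (2 + d) e) ≡ k * cover D e + b (1 + d) * χ (L (1 + d) e)
      cover[D-1]+c·χ[D-1]≡k·cover[D]+b·χ[D-2] e = byLevel (Dist-level e) (topLevel (level≤D e))
        where
        c′ = c (2 + d)
        b′ = b (1 + d)
        LHS = cover (2 + d) e + c′ * χ (L (2 + d) e)
        RHS = k * cover D e + b′ * χ (L (1 + d) e)
        evaluate : ∀ {w y u z} → cover (2 + d) e ≡ w → χ (L (2 + d) e) ≡ y → cover D e ≡ u → χ (L (1 + d) e) ≡ z →
          w + c′ * y ≡ k * u + b′ * z → LHS ≡ RHS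
        evaluate w y u z values =
          trans (cong₂ (λ w y → w + c′ * y) w y) (trans values (sym (cong₂ (λ u z → k * u + b′ * z) u z)))
        rearrange : ∀ x y → 1 + y + x * 1 ≡ (x + y + 1) * 1 + 0
        rearrange = solve-∀
        byLevel : ∀ {i} → Dist i e o → TopLevel i → LHS ≡ RHS
        byLevel h top =
          evaluate (cover-down h) (χL-≢ (2 + d) h (>⇒≢ ≤-refl))
                   (trans (cover[D]≡χ[D-1]+χ[D] e) (cong₂ _+_ (χL-≢ (2 + d) h (>⇒≢ ≤-refl)) (χL-self h)))
                   (χL-≢ (1 + d) h (>⇒≢ (n≤1+n _)))
                   (trans (cong₂ _+_ c[D]≡k (*-zeroʳ c′)) (sym (cong₂ _+_ (*-identityʳ k) (*-zeroʳ b′))))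
        byLevel h top-1 =
          evaluate (cover-same h) (χL-self h) (trans (cover-up h) b[D-1]≡1) (χL-≢ (1 + d) h (>⇒≢ ≤-refl))
                   (trans (rearrange c′ (nbrs (2 + d) e)) (cong₂ (λ x y → x * 1 + y) (sym k≡c′+a+1) (sym (*-zeroʳ b′))))
          where
          k≡c′+a+1 : k ≡ c′ + nbrs (2 + d) e + 1
          k≡c′+a+1 = trans (degree-split h)
                           (cong₂ _+_ (cong (_+ nbrs (2 + d) e) (nbrs-down h)) (trans (nbrs-up h) b[D-1]≡1))
        byLevel h top-2 =
          evaluate (cover-up h) (χL-≢ (2 + d) h (<⇒≢ ≤-refl)) (cover-far D h (inj₁ ≤-refl)) (χL-self h)
                   (trans (cong (b′ +_) (*-zeroʳ c′))
                          (trans (+-identityʳ b′) (sym (cong₂ _+_ (*-zeroʳ k) (*-identityʳ b′)))))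
        byLevel h (lower i≤d) =
          evaluate (cover-far (2 + d) h (inj₁ (s≤s (s≤s i≤d)))) (χL-≢ (2 + d) h (<⇒≢ (s≤s i≤1+d)))
                   (cover-far D h (inj₁ (s≤s (s≤s i≤1+d)))) (χL-≢ (1 + d) h (<⇒≢ (s≤s i≤d)))
                   (trans (*-zeroʳ c′) (sym (cong₂ _+_ (*-zeroʳ k) (*-zeroʳ b′))))
          where
          i≤1+d = m≤n⇒m≤1+n i≤d

      size[D]≡codeSize[D-1]+codeSize[D] : size D ≡ codeSize (2 + d) + codeSize D
      size[D]≡codeSize[D-1]+codeSize[D] = begin
        size D                                          ≡⟨ size≡∑code-cover D ⟩
        ∑code (cover D)                                 ≡⟨ ∑code-cong (λ e _ → cover[D]≡χ[D-1]+χ[D] e) ⟩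
        ∑code (λ e → χ (L (2 + d) e) + χ (L D e))       ≡⟨ ∑code-+ (χ ∘ L (2 + d)) (χ ∘ L D) ⟩
        ∑code (χ ∘ L (2 + d)) + ∑code (χ ∘ L D)
          ≡⟨ cong₂ _+_ (∑code-level (2 + d)) (∑code-level D) ⟩
        codeSize (2 + d) + codeSize D                   ∎
        where open ≡-Reasoning

      c·codeSize[D-1]≡b·codeSize[D-2] : c (2 + d) * codeSize (2 + d) ≡ b (1 + d) * codeSize (1 + d)
      c·codeSize[D-1]≡b·codeSize[D-2] = +-cancelˡ-≡ (k * size D) _ _ (begin
        k * size D + c′ * codeSize (2 + d)
          ≡⟨ cong₂ _+_ size[D-1]≡k*size[D] (cong (c′ *_) (∑code-level (2 + d))) ⟨
        size (2 + d) + c′ * ∑code (χ ∘ L (2 + d))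
          ≡⟨ cong₂ _+_ (size≡∑code-cover (2 + d)) (sym (∑code-* c′ (χ ∘ L (2 + d)))) ⟩
        ∑code (cover (2 + d)) + ∑code (λ e → c′ * χ (L (2 + d) e))
          ≡⟨ ∑code-+ (cover (2 + d)) (λ e → c′ * χ (L (2 + d) e)) ⟨
        ∑code (λ e → cover (2 + d) e + c′ * χ (L (2 + d) e))
          ≡⟨ ∑code-cong (λ e _ → cover[D-1]+c·χ[D-1]≡k·cover[D]+b·χ[D-2] e) ⟩
        ∑code (λ e → k * cover D e + b′ * χ (L (1 + d) e))
          ≡⟨ ∑code-+ (λ e → k * cover D e) (λ e → b′ * χ (L (1 + d) e)) ⟩
        ∑code (λ e → k * cover D e) + ∑code (λ e → b′ * χ (L (1 + d) e))
          ≡⟨ cong₂ _+_ (∑code-* k (cover D)) (∑code-* b′ (χ ∘ L (1 + d))) ⟩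
        k * ∑code (cover D) + b′ * ∑code (χ ∘ L (1 + d))
          ≡⟨ cong₂ _+_ (cong (k *_) (size≡∑code-cover D)) (cong (b′ *_) (sym (∑code-level (1 + d)))) ⟨
        k * size D + b′ * codeSize (1 + d)
          ∎)
        where
        open ≡-Reasoning
        c′ = c (2 + d)
        b′ = b (1 + d)

diameter5-infeasible : ∀ {l₂ l₃ l₄ l₅ n₃ n₄ n₅ b₂ b₃ c₃ c₄ k : ℕ} →
  l₂ ≡ c₃ * n₃ → c₄ * n₄ ≡ b₃ * n₃ → b₂ * l₂ ≡ c₃ * l₃ → b₃ * l₃ ≡ c₄ * l₄ →
  l₄ ≡ k * l₅ → l₅ ≡ n₄ + n₅ → 1 ≤ c₃ → 1 ≤ c₄ → 1 ≤ l₅ → b₂ < k → ⊥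
diameter5-infeasible {l₂} {l₃} {l₄} {l₅} {n₃} {n₄} {n₅} {b₂} {b₃} {c₃} {c₄} {k}
  l₂≡ c₄n₄≡b₃n₃ edge₂ edge₃ l₄≡ l₅≡ c₃>0 c₄>0 l₅>0 b₂<k = <-irrefl b₂n₄≡kl₅ b₂n₄<kl₅
  where
  open ≡-Reasoning
  scaled : (c₃ * c₄) * (b₂ * n₄) ≡ (c₃ * c₄) * (k * l₅)
  scaled = begin
    (c₃ * c₄) * (b₂ * n₄)   ≡⟨ lemma₁ c₃ c₄ b₂ n₄ ⟩
    (b₂ * c₃) * (c₄ * n₄)   ≡⟨ cong ((b₂ * c₃) *_) c₄n₄≡b₃n₃ ⟩
    (b₂ * c₃) * (b₃ * n₃)   ≡⟨ lemma₂ b₂ c₃ b₃ n₃ ⟩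
    b₃ * (b₂ * (c₃ * n₃))   ≡⟨ cong (λ x → b₃ * (b₂ * x)) l₂≡ ⟨
    b₃ * (b₂ * l₂)          ≡⟨ cong (b₃ *_) edge₂ ⟩
    b₃ * (c₃ * l₃)          ≡⟨ x∙yz≈y∙xz b₃ c₃ l₃ ⟩
    c₃ * (b₃ * l₃)          ≡⟨ cong (c₃ *_) edge₃ ⟩
    c₃ * (c₄ * l₄)          ≡⟨ *-assoc c₃ c₄ l₄ ⟨
    (c₃ * c₄) * l₄          ≡⟨ cong ((c₃ * c₄) *_) l₄≡ ⟩
    (c₃ * c₄) * (k * l₅)    ∎
    where
    lemma₁ : ∀ x y z w → (x * y) * (z * w) ≡ (z * x) * (y * w)
    lemma₁ = solve-∀
    lemma₂ : ∀ x y z w → (x * y) * (z * w) ≡ z * (x * (y * w))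
    lemma₂ = solve-∀
  b₂n₄≡kl₅ : b₂ * n₄ ≡ k * l₅
  b₂n₄≡kl₅ = *-cancelˡ-≡ _ _ (c₃ * c₄) {{>-nonZero (*-mono-≤ c₃>0 c₄>0)}} scaled
  b₂n₄<kl₅ : b₂ * n₄ < k * l₅
  b₂n₄<kl₅ = ≤-<-trans (*-monoʳ-≤ b₂ (subst (n₄ ≤_) (sym l₅≡) (m≤m+n n₄ n₅)))
                       (*-monoˡ-< l₅ {{>-nonZero l₅>0}} b₂<k)

codeword-exists : ∀ {n} (G : Graph n) (C : Fin n → Bool) → PerfectCode G C → Fin n → ∃ λ o → C o ≡ true
codeword-exists G C perfect v with count-witness (λ e → C e ∧ inClosedNbhd G e v) (≤-reflexive (sym (perfect v)))
... | o , Co∧ = o , proj₁ (∧-true⁻ {C o} Co∧)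

no-perfect-code-diameter-4 : ∀ {n} (G : Graph n) → DistanceRegular G → HasDiameter G 4 → Antipodal G 4 →
  (C : Fin n → Bool) → ¬ PerfectCode G C
no-perfect-code-diameter-4 G (_ , b , c , b-spec , c-spec) diam antipodal C perfect
  with codeword-exists G C perfect (proj₁ (proj₂ diam))
... | o , Co = 1+n≰n (begin
  1                   ≤⟨ size-pos 2 (s≤s (s≤s z≤n)) ⟩
  size 2              ≡⟨ size[2]≡c₃*codeSize[3] ⟩
  c 3 * codeSize 3    ≡⟨ c·codeSize[D-1]≡b·codeSize[D-2] ⟩
  b 2 * codeSize 2    ≡⟨ cong (b 2 *_) codeSize[2]≡0 ⟩
  b 2 * 0             ≡⟨ *-zeroʳ (b 2) ⟩
  0                   ∎)
  where
  open ≤-Reasoning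
  open DistanceRegularGraph G b c b-spec c-spec
  open Layers 1 diam o
  open PerfectCodeCounting C perfect
  open CodewordAtBase Co
  open AntipodalPerfectCode antipodal C perfect

no-perfect-code-diameter-5 : ∀ {n} (G : Graph n) → DistanceRegular G → HasDiameter G 5 → Antipodal G 5 →
  (C : Fin n → Bool) → ¬ PerfectCode G C
no-perfect-code-diameter-5 G (_ , b , c , b-spec , c-spec) diam antipodal C perfect
  with codeword-exists G C perfect (proj₁ (proj₂ diam))
... | o , Co = diameter5-infeasible {b₃ = b 3}
  size[2]≡c₃*codeSize[3] c·codeSize[D-1]≡b·codeSize[D-2] (size-edge 2) (size-edge 3)
  size[D-1]≡k*size[D] size[D]≡codeSize[D-1]+codeSize[D]
  (c-pos 2 (s≤s (s≤s (s≤s z≤n)))) (c-pos 3 (s≤s (s≤s (s≤s (s≤s z≤n))))) (size-pos 5 ≤-refl) (b<k 1 (s≤s (s≤s z≤n)))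
  where
  open DistanceRegularGraph G b c b-spec c-spec
  open Layers 2 diam o
  open PerfectCodeCounting C perfect
  open CodewordAtBase Co
  open Antipodality antipodal
  open AntipodalPerfectCode antipodal C perfect

corollary3p3 : ∀ (n : ℕ) (G : Graph n) (d : ℕ) → (d ≡ 4 ⊎ d ≡ 5) →
    DistanceRegular G → HasDiameter G d → Antipodal G d →
    (C : Fin n → Bool) → ¬ PerfectCode G C
corollary3p3 n G .4 (inj₁ refl) = no-perfect-code-diameter-4 G
corollary3p3 n G .5 (inj₂ refl) = no-perfect-code-diameter-5 G
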